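{- Let $n \geq 1$ and $k \geq 3$ be integers and let $T_{n,k}$ be the dendrimer. Then its Wiener index is $$W(T_{n, k}) = \sum^{n-1}_{l=0}(2l+1)k(k-1)^{l}\cdot\frac{(k-1)^{n}-(k-1)^{l}}{k-2}+\sum^{n}_{l=1}(2l)\frac{k(k-1)^{2l-1}}{2} \cdot\frac{k(k-1)^{n-l}-2}{k-2}.$$
   Context: For integers $n \geq 1$ and $k \geq 2$, the dendrimer $T_{n,k}$ is the rooted tree with a root $r$ such that every vertex at distance less than $n$ from $r$ has degree exactly $k$ and every vertex at distance exactly $n$ from $r$ is a leaf. The Wiener index of a connected graph $G$ is $W(G) = \sum_{\{u,v\}\subseteq V(G)} d_G(u,v)$, the sum of distances over all unordered pairs of distinct vertices. -}

module Defs where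

open import Data.Nat using (ℕ; zero; suc; _+_; _*_; _∸_; _^_; _≤_)
open import Data.Nat.DivMod using (_/_)
open import Data.Bool using (Bool; true; false; _∧_; _∨_; if_then_else_)
open import Data.List using (List; []; _∷_; map; concatMap; concat; upTo; length)
open import Data.Nat.ListAction using (sum)
open import Data.Bool.ListAction using (any)
open import Data.List.Properties using (≡-dec)
open import Data.Nat.Properties using (_≟_)
open import Relation.Nullary.Decidable using (⌊_⌋)

-- Finite graphs given by an explicit duplicate-free vertex list and a
-- decidable (Boolean) adjacency relation.

record FinGraph (V : Set) : Set where
  field
    vertices : List V
    adj      : V → V → Bool
open FinGraph public

module _ {V : Set} (eq : V → V → Bool) (G : FinGraph V) where

  reach : ℕ → V → V → Bool
  reach zero    u v = eq u v
  reach (suc m) u v = any (λ w → adj G u w ∧ reach m w v) (vertices G)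

  -- least m in [start, start + fuel) such that reach m u v; searching up
  -- to the number of vertices suffices for connected graphs.
  firstReach : ℕ → ℕ → V → V → ℕ
  firstReach start zero       u v = start
  firstReach start (suc fuel) u v =
    if reach start u v then start else firstReach (suc start) fuel u v

  dist : V → V → ℕ
  dist u v = firstReach 0 (length (vertices G)) u v

  pairSum : List V → ℕ
  pairSum []       = 0
  pairSum (x ∷ xs) = sum (map (dist x) xs) + pairSum xs

  wiener : ℕ
  wiener = pairSum (vertices G)

-- A vertex is the list of choices along the path from the root r = [],
-- most recent choice first: the root has k children (labels 0..k-1),
-- every other non-leaf vertex has k-1 children (labels 0..k-2), so every
-- vertex at depth < n has degree k, and vertices at depth n are leaves.

DVertex : Set
DVertex = List ℕ

dEq : DVertex → DVertex → Bool
dEq u v = ⌊ ≡-dec _≟_ u v ⌋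

level : ℕ → ℕ → List DVertex
level k zero          = [] ∷ []
level k (suc zero)    = map (λ i → i ∷ []) (upTo k)
level k (suc (suc l)) = concatMap (λ w → map (λ i → i ∷ w) (upTo (k ∸ 1))) (level k (suc l))

dVertices : ℕ → ℕ → List DVertex
dVertices zero    k = level k zero
dVertices (suc n) k = dVertices n k Data.List.++ level k (suc n)

isChild : DVertex → DVertex → Bool
isChild u []      = false
isChild u (_ ∷ w) = dEq u w

dAdj : DVertex → DVertex → Bool
dAdj u v = isChild u v ∨ isChild v u

dendrimer : ℕ → ℕ → FinGraph DVertex
dendrimer n k = record { vertices = dVertices n k ; adj = dAdj }

-- The closed formula (all divisions are exact for k ≥ 3).

divBy : ℕ → ℕ → ℕ
divBy a zero    = 0
divBy a (suc d) = a / suc d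

formula : ℕ → ℕ → ℕ
formula n k =
    sum (map (λ l → (2 * l + 1) * k * (k ∸ 1) ^ l
                    * divBy ((k ∸ 1) ^ n ∸ (k ∸ 1) ^ l) (k ∸ 2))
             (upTo n))
  + sum (map (λ i → let l = suc i in
                    (2 * l) * divBy (k * (k ∸ 1) ^ (2 * l ∸ 1)) 2
                    * divBy (k * (k ∸ 1) ^ (n ∸ l) ∸ 2) (k ∸ 2))
             (upTo n))

-- Vertices of T_{n,k} are lists of child choices, and the breadth-first
-- distance of the graph agrees with the tree distance computed by climbing
-- to the common ancestor.  Splitting T_{n+1,k} into T_{n,k} and its last
-- level, the ordered distance sums within the last level, from T_{n,k} to
-- it, and within T_{n+1,k} satisfy linear recurrences; solving them gives
-- (k-2)³ · 2 W(T_{n,k}) as a polynomial in k, n and (k-1)^n.  Clearing the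
-- denominators of the formula reduces it to geometric and
-- arithmetico-geometric sums in (k-1) and (k-1)², which yield the same
-- polynomial.
module Submission where

open import Defs
open import Data.Nat using (ℕ; _≤_)
open import Relation.Binary.PropositionalEquality using (_≡_)

module Dendrimer where

  open import Data.Bool using (Bool; true; false; _∧_; _∨_; if_then_else_)
  open import Data.Bool.ListAction using (any)
  open import Data.Bool.Properties using (∨-zeroʳ; ¬-not)
  open import Data.Empty using (⊥-elim)
  open import Data.List using (List; []; _∷_; _++_; map; concatMap; upTo; length; drop; [_])
  open import Data.List.Membership.Propositional using (_∈_; find)
  open import Data.List.Membership.Propositional.Properties
    using (∈-map⁺; ∈-map⁻; ∈-upTo⁺; ∈-upTo⁻; ∈-concatMap⁺; ∈-concatMap⁻; ∈-++⁺ˡ; ∈-++⁺ʳ; ∈-++⁻)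
  open import Data.List.Properties
    using (≡-dec; length-++; length-map; length-upTo; upTo-∷ʳ; map-++; ++-identityʳ)
  open import Data.List.Relation.Binary.Pointwise using (Pointwise-≡⇒≡; ≡⇒Pointwise-≡)
  open import Data.List.Relation.Binary.Suffix.Heterogeneous using (Suffix; here; there)
  open import Data.List.Relation.Binary.Suffix.Heterogeneous.Properties using (length-mono)
  open import Data.List.Relation.Unary.Any as Any using (Any; here; there)
  open import Data.Nat using (ℕ; zero; suc; _+_; _*_; _∸_; _^_; _≤_; _<_; _≤?_; z≤n; s≤s)
  open import Data.Nat.ListAction using (sum)
  open import Data.Nat.ListAction.Properties using (sum-++)
  open import Data.Nat.Properties
  open import Data.Nat.Tactic.RingSolver using (solve-∀)
  open import Data.Product using (_×_; _,_; proj₁; proj₂; ∃-syntax)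
  open import Data.Sum using (_⊎_; inj₁; inj₂)
  open import Data.Unit using (⊤; tt)
  open import Function using (_∘_)
  open import Relation.Binary.PropositionalEquality hiding ([_])
  open import Relation.Nullary using (yes; no)
  open import Relation.Nullary.Decidable using (⌊_⌋; isYes≗does; dec-true; dec-false; toSum)

  private
    variable
      A B : Set

  -- Finite sums over lists

  sumOf : (A → ℕ) → List A → ℕ
  sumOf f xs = sum (map f xs)

  sumOf-cong : ∀ {f g : A → ℕ} xs → (∀ {x} → x ∈ xs → f x ≡ g x) → sumOf f xs ≡ sumOf g xs
  sumOf-cong []       f≗g = refl
  sumOf-cong (x ∷ xs) f≗g = cong₂ _+_ (f≗g (here refl)) (sumOf-cong xs (f≗g ∘ there))

  sumOf-++ : ∀ (f : A → ℕ) xs ys → sumOf f (xs ++ ys) ≡ sumOf f xs + sumOf f ys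
  sumOf-++ f xs ys = trans (cong sum (map-++ f xs ys)) (sum-++ (map f xs) (map f ys))

  sumOf-+ : ∀ (f g : A → ℕ) xs → sumOf (λ x → f x + g x) xs ≡ sumOf f xs + sumOf g xs
  sumOf-+ f g []       = refl
  sumOf-+ f g (x ∷ xs) rewrite sumOf-+ f g xs = +-shuffle (f x) (g x) (sumOf f xs) (sumOf g xs)
    where
    +-shuffle : ∀ a b c d → a + b + (c + d) ≡ a + c + (b + d)
    +-shuffle = solve-∀

  sumOf-*ˡ : ∀ c (f : A → ℕ) xs → sumOf (λ x → c * f x) xs ≡ c * sumOf f xs
  sumOf-*ˡ c f []       = sym (*-zeroʳ c)
  sumOf-*ˡ c f (x ∷ xs) rewrite sumOf-*ˡ c f xs = sym (*-distribˡ-+ c (f x) (sumOf f xs))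

  sumOf-const : ∀ c (xs : List A) → sumOf (λ _ → c) xs ≡ length xs * c
  sumOf-const c []       = refl
  sumOf-const c (x ∷ xs) = cong (c +_) (sumOf-const c xs)

  sumOf-map : ∀ (f : A → ℕ) (g : B → A) xs → sumOf f (map g xs) ≡ sumOf (λ x → f (g x)) xs
  sumOf-map f g []       = refl
  sumOf-map f g (x ∷ xs) = cong (f (g x) +_) (sumOf-map f g xs)

  sumOf-concatMap : ∀ (f : A → ℕ) (g : B → List A) xs →
                    sumOf f (concatMap g xs) ≡ sumOf (λ x → sumOf f (g x)) xs
  sumOf-concatMap f g []       = refl
  sumOf-concatMap f g (x ∷ xs) =
    trans (sumOf-++ f (g x) (concatMap g xs)) (cong (sumOf f (g x) +_) (sumOf-concatMap f g xs))

  sumProduct : (A → B → ℕ) → List A → List B → ℕ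
  sumProduct f as bs = sumOf (λ a → sumOf (f a) bs) as

  sumProduct-++ˡ : ∀ (f : A → B → ℕ) as as′ bs →
                   sumProduct f (as ++ as′) bs ≡ sumProduct f as bs + sumProduct f as′ bs
  sumProduct-++ˡ f as as′ bs = sumOf-++ (λ a → sumOf (f a) bs) as as′

  sumProduct-++ʳ : ∀ (f : A → B → ℕ) as bs bs′ →
                   sumProduct f as (bs ++ bs′) ≡ sumProduct f as bs + sumProduct f as bs′
  sumProduct-++ʳ f as bs bs′ =
    trans (sumOf-cong as (λ {a} _ → sumOf-++ (f a) bs bs′)) (sumOf-+ _ _ as)

  sumProduct-swap : ∀ (f : A → B → ℕ) as bs → sumProduct f as bs ≡ sumProduct (λ b a → f a b) bs as
  sumProduct-swap f []       bs = sym (trans (sumOf-const 0 bs) (*-zeroʳ (length bs)))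
  sumProduct-swap f (a ∷ as) bs =
    trans (cong (sumOf (f a) bs +_) (sumProduct-swap f as bs)) (sym (sumOf-+ (f a) _ bs))

  sumPairs : (A → A → ℕ) → List A → ℕ
  sumPairs f []       = 0
  sumPairs f (x ∷ xs) = sumOf (f x) xs + sumPairs f xs

  sumPairs-cong : ∀ {f g : A → A → ℕ} xs → (∀ {x y} → x ∈ xs → y ∈ xs → f x y ≡ g x y) →
                  sumPairs f xs ≡ sumPairs g xs
  sumPairs-cong []       f≗g = refl
  sumPairs-cong (x ∷ xs) f≗g =
    cong₂ _+_ (sumOf-cong xs (f≗g (here refl) ∘ there)) (sumPairs-cong xs (λ p q → f≗g (there p) (there q)))

  twice-sumPairs : ∀ (f : A → A → ℕ) → (∀ x y → f x y ≡ f y x) → (∀ x → f x x ≡ 0) →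
                   ∀ xs → 2 * sumPairs f xs ≡ sumProduct f xs xs
  twice-sumPairs f sym-f diag-f []       = refl
  twice-sumPairs f sym-f diag-f (x ∷ xs) = begin
    2 * (row + sumPairs f xs)                        ≡⟨ *-distribˡ-+ 2 row (sumPairs f xs) ⟩
    2 * row + 2 * sumPairs f xs                      ≡⟨ cong (2 * row +_) (twice-sumPairs f sym-f diag-f xs) ⟩
    2 * row + sumProduct f xs xs                     ≡⟨ double row (sumProduct f xs xs) ⟩
    row + (row + sumProduct f xs xs)                 ≡⟨ cong₂ (λ d c → d + row + (c + sumProduct f xs xs))
                                                              (sym (diag-f x)) (sumOf-cong xs (λ {y} _ → sym-f x y)) ⟩
    f x x + row + (sumOf (λ y → f y x) xs + sumProduct f xs xs)
                                                     ≡⟨ cong (f x x + row +_) (sym (sumOf-+ (λ y → f y x) _ xs)) ⟩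
    sumProduct f (x ∷ xs) (x ∷ xs)                   ∎
    where
    open ≡-Reasoning
    row = sumOf (f x) xs
    double : ∀ a b → 2 * a + b ≡ a + (a + b)
    double = solve-∀

  -- Distance in the tree of choice lists

  dEq-refl : ∀ u → dEq u u ≡ true
  dEq-refl u = trans (isYes≗does (≡-dec _≟_ u u)) (dec-true (≡-dec _≟_ u u) refl)

  dEq-false : ∀ {u v} → u ≢ v → dEq u v ≡ false
  dEq-false {u} {v} u≢v = trans (isYes≗does (≡-dec _≟_ u v)) (dec-false (≡-dec _≟_ u v) u≢v)

  dEq-sound : ∀ {u v} → dEq u v ≡ true → u ≡ v
  dEq-sound {u} {v} eq with ≡-dec _≟_ u v
  ... | yes u≡v = u≡v

  eqIndicator : DVertex → DVertex → ℕ
  eqIndicator u v = if dEq u v then 1 else 0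

  -- Ancestors of a vertex are its suffixes.  Two vertices are joined by
  -- first climbing from the deeper one to the depth of the other, and then
  -- from both in parallel until they meet.
  sameDepthDist : DVertex → DVertex → ℕ
  sameDepthDist []      _       = 0
  sameDepthDist (i ∷ x) []      = 0
  sameDepthDist (i ∷ x) (j ∷ y) = if dEq (i ∷ x) (j ∷ y) then 0 else 2 + sameDepthDist x y

  treeDist : DVertex → DVertex → ℕ
  treeDist x y = (length x ∸ length y) + (length y ∸ length x)
               + sameDepthDist (drop (length x ∸ length y) x) (drop (length y ∸ length x) y)

  sameDepthDist-refl : ∀ x → sameDepthDist x x ≡ 0
  sameDepthDist-refl []      = refl
  sameDepthDist-refl (i ∷ x) rewrite dEq-refl (i ∷ x) = refl

  sameDepthDist-sym : ∀ x y → sameDepthDist x y ≡ sameDepthDist y x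
  sameDepthDist-sym []      []      = refl
  sameDepthDist-sym []      (j ∷ y) = refl
  sameDepthDist-sym (i ∷ x) []      = refl
  sameDepthDist-sym (i ∷ x) (j ∷ y) with toSum (≡-dec _≟_ (i ∷ x) (j ∷ y))
  ... | inj₁ refl = refl
  ... | inj₂ ≢    rewrite dEq-false ≢ | dEq-false (≢ ∘ sym) | sameDepthDist-sym x y = refl

  sameDepthDist≡0⇒≡ : ∀ x y → length x ≡ length y → sameDepthDist x y ≡ 0 → x ≡ y
  sameDepthDist≡0⇒≡ []      []      _ _ = refl
  sameDepthDist≡0⇒≡ (i ∷ x) (j ∷ y) _ d≡0 with toSum (≡-dec _≟_ (i ∷ x) (j ∷ y))
  ... | inj₁ eq = eq
  ... | inj₂ ≢  rewrite dEq-false ≢ with d≡0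
  ...   | ()

  treeDist-refl : ∀ x → treeDist x x ≡ 0
  treeDist-refl x rewrite n∸n≡0 (length x) = sameDepthDist-refl x

  treeDist-sym : ∀ x y → treeDist x y ≡ treeDist y x
  treeDist-sym x y
    rewrite sameDepthDist-sym (drop (length x ∸ length y) x) (drop (length y ∸ length x) y)
          | +-comm (length x ∸ length y) (length y ∸ length x) = refl

  treeDist-sameDepth : ∀ x y → length x ≡ length y → treeDist x y ≡ sameDepthDist x y
  treeDist-sameDepth x y eq rewrite eq | n∸n≡0 (length y) = refl

  treeDist≡0⇒≡ : ∀ x y → treeDist x y ≡ 0 → x ≡ y
  treeDist≡0⇒≡ x y d≡0 =
    sameDepthDist≡0⇒≡ x y same (trans (sym (treeDist-sameDepth x y same)) d≡0)
    where
    climbs≡0 = m+n≡0⇒m≡0 _ d≡0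
    same : length x ≡ length y
    same = ≤-antisym (m∸n≡0⇒m≤n (m+n≡0⇒m≡0 _ climbs≡0)) (m∸n≡0⇒m≤n (m+n≡0⇒n≡0 _ climbs≡0))

  treeDist-childʳ : ∀ i x y → length x ≤ length y → treeDist x (i ∷ y) ≡ suc (treeDist x y)
  treeDist-childʳ i x y x≤y
    rewrite m≤n⇒m∸n≡0 (m≤n⇒m≤1+n x≤y) | m≤n⇒m∸n≡0 x≤y | +-∸-assoc 1 x≤y = refl

  treeDist-childˡ : ∀ i x y → length y ≤ length x → treeDist (i ∷ x) y ≡ suc (treeDist x y)
  treeDist-childˡ i x y y≤x =
    trans (treeDist-sym (i ∷ x) y) (trans (treeDist-childʳ i y x y≤x) (cong suc (treeDist-sym y x)))

  treeDist-siblings : ∀ i j x y → length x ≡ length y → (i ∷ x) ≢ (j ∷ y) →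
                      treeDist (i ∷ x) (j ∷ y) ≡ 2 + treeDist x y
  treeDist-siblings i j x y eq ≢
    rewrite treeDist-sameDepth (i ∷ x) (j ∷ y) (cong suc eq) | treeDist-sameDepth x y eq | dEq-false ≢ = refl

  treeDist-sameDepth-children : ∀ i j x y → length x ≡ length y →
    treeDist (i ∷ x) (j ∷ y) + 2 * eqIndicator (i ∷ x) (j ∷ y) ≡ treeDist x y + 2
  treeDist-sameDepth-children i j x y eq with toSum (≡-dec _≟_ (i ∷ x) (j ∷ y))
  ... | inj₁ refl rewrite treeDist-refl (i ∷ x) | dEq-refl (i ∷ x) | treeDist-refl x = refl
  ... | inj₂ ≢    rewrite treeDist-siblings i j x y eq ≢ | dEq-false ≢ =
    trans (+-identityʳ (2 + treeDist x y)) (+-comm 2 (treeDist x y))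

  treeDist-child-step : ∀ i u v → treeDist (i ∷ u) v ≡ suc (treeDist u v)
                                ⊎ suc (treeDist (i ∷ u) v) ≡ treeDist u v
  treeDist-child-step i u []      = inj₁ (treeDist-childˡ i u [] z≤n)
  treeDist-child-step i u (j ∷ v) with suc (length v) ≤? length u
  ... | yes v<u = inj₁ (treeDist-childˡ i u (j ∷ v) v<u)
  ... | no  v≮u with m≤n⇒m<n∨m≡n (≤-pred (≰⇒> v≮u))
  ...   | inj₁ u<v with treeDist-child-step i u v
  ...     | inj₁ further = inj₁ (begin
            treeDist (i ∷ u) (j ∷ v) ≡⟨ treeDist-childʳ j (i ∷ u) v u<v ⟩
            suc (treeDist (i ∷ u) v) ≡⟨ cong suc further ⟩
            suc (suc (treeDist u v)) ≡⟨ cong suc (treeDist-childʳ j u v (<⇒≤ u<v)) ⟨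
            suc (treeDist u (j ∷ v)) ∎)
            where open ≡-Reasoning
  ...     | inj₂ closer  = inj₂ (begin
            suc (treeDist (i ∷ u) (j ∷ v)) ≡⟨ cong suc (treeDist-childʳ j (i ∷ u) v u<v) ⟩
            suc (suc (treeDist (i ∷ u) v)) ≡⟨ cong suc closer ⟩
            suc (treeDist u v)             ≡⟨ treeDist-childʳ j u v (<⇒≤ u<v) ⟨
            treeDist u (j ∷ v)             ∎)
            where open ≡-Reasoning
  treeDist-child-step i u (j ∷ v) | no _ | inj₂ u≡v with toSum (≡-dec _≟_ (i ∷ u) (j ∷ v))
  ... | inj₁ refl = inj₂ (trans (cong suc (treeDist-refl (i ∷ u)))
                                (sym (trans (treeDist-childʳ i u u ≤-refl) (cong suc (treeDist-refl u)))))
  ... | inj₂ ≢    = inj₁ (trans (treeDist-siblings i j u v u≡v ≢)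
                                (cong suc (sym (treeDist-childʳ j u v (≤-reflexive u≡v)))))

  treeDist-child≤ : ∀ i u v → treeDist (i ∷ u) v ≤ suc (treeDist u v)
  treeDist-child≤ i u v with treeDist-child-step i u v
  ... | inj₁ eq = ≤-reflexive eq
  ... | inj₂ eq = ≤-trans (n≤1+n _) (≤-trans (≤-reflexive eq) (n≤1+n _))

  treeDist-parent≤ : ∀ i u v → treeDist u v ≤ suc (treeDist (i ∷ u) v)
  treeDist-parent≤ i u v with treeDist-child-step i u v
  ... | inj₁ eq = ≤-trans (n≤1+n _) (≤-trans (≤-reflexive (sym eq)) (n≤1+n _))
  ... | inj₂ eq = ≤-reflexive (sym eq)

  treeDist-root : ∀ x → treeDist x [] ≡ length x
  treeDist-root []      = refl
  treeDist-root (i ∷ x) = trans (treeDist-childˡ i x [] z≤n) (cong suc (treeDist-root x))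

  treeDist≤depths : ∀ x y → treeDist x y ≤ length x + length y
  treeDist≤depths x []      = ≤-reflexive (trans (treeDist-root x) (sym (+-identityʳ (length x))))
  treeDist≤depths x (j ∷ y) = begin
    treeDist x (j ∷ y)          ≡⟨ treeDist-sym x (j ∷ y) ⟩
    treeDist (j ∷ y) x          ≤⟨ treeDist-child≤ j y x ⟩
    suc (treeDist y x)          ≡⟨ cong suc (treeDist-sym y x) ⟩
    suc (treeDist x y)          ≤⟨ s≤s (treeDist≤depths x y) ⟩
    suc (length x + length y)   ≡⟨ +-suc (length x) (length y) ⟨
    length x + length (j ∷ y)   ∎
    where open ≤-Reasoning

  _≼_ : DVertex → DVertex → Set
  _≼_ = Suffix _≡_

  -- One step along a shortest path from u towards v: either up to the
  -- parent of u, or down to the child of u that is an ancestor of v.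
  data Descent (u v : DVertex) (d : ℕ) : Set where
    up   : ∀ i u′ → u ≡ i ∷ u′ → treeDist u′ v ≡ d → Descent u v d
    down : ∀ j → (j ∷ u) ≼ v → treeDist (j ∷ u) v ≡ d → Descent u v d

  descent : ∀ u v d → treeDist u v ≡ suc d → Descent u v d
  descent []      []      d ()
  descent (i ∷ u) []      d eq = up i u refl (suc-injective (trans (sym (treeDist-childˡ i u [] z≤n)) eq))
  descent u       (j ∷ v) d eq with suc (length v) ≤? length u
  descent []      (j ∷ v) d eq | yes ()
  descent (i ∷ u) (j ∷ v) d eq | yes v<u with m≤n⇒m<n∨m≡n v<u
  ... | inj₁ v<u′ = up i u refl (suc-injective (trans (sym (treeDist-childˡ i u (j ∷ v) (≤-pred v<u′))) eq))
  ... | inj₂ v≡u with toSum (≡-dec _≟_ (i ∷ u) (j ∷ v))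
  ...   | inj₁ refl rewrite treeDist-refl (i ∷ u) with eq
  ...     | ()
  descent (i ∷ u) (j ∷ v) d eq | yes _ | inj₂ v≡u | inj₂ ≢ =
    up i u refl (trans (treeDist-childʳ j u v (≤-reflexive (sym (suc-injective v≡u))))
                       (suc-injective (trans (sym (treeDist-siblings i j u v (sym (suc-injective v≡u)) ≢)) eq)))
  descent u (j ∷ v) d eq | no v≮u = towards d (suc-injective (trans (sym (treeDist-childʳ j u v u≤v)) eq))
    where
    u≤v : length u ≤ length v
    u≤v = ≤-pred (≰⇒> v≮u)
    towards : ∀ d → treeDist u v ≡ d → Descent u (j ∷ v) d
    towards zero    u~v with treeDist≡0⇒≡ u v u~v
    ... | refl = down j (here (≡⇒Pointwise-≡ refl)) (treeDist-refl (j ∷ u))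
    towards (suc d) u~v with descent u v d u~v
    ... | up i u′ refl p = up i u′ refl (trans (treeDist-childʳ j u′ v (≤-trans (n≤1+n _) u≤v)) (cong suc p))
    ... | down j′ s p    = down j′ (there s) (trans (treeDist-childʳ j (j′ ∷ u) v (length-mono s)) (cong suc p))

  Valid : ℕ → DVertex → Set
  Valid k []          = ⊤
  Valid k (i ∷ [])    = i < k
  Valid k (i ∷ j ∷ x) = i < k ∸ 1 × Valid k (j ∷ x)

  Valid-parent : ∀ {k i x} → Valid k (i ∷ x) → Valid k x
  Valid-parent {x = []}    _       = tt
  Valid-parent {x = j ∷ x} (_ , v) = v

  Valid-≼ : ∀ {k w v} → w ≼ v → Valid k v → Valid k w
  Valid-≼ (here w≈v) v rewrite Pointwise-≡⇒≡ w≈v = v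
  Valid-≼ (there s)  v = Valid-≼ s (Valid-parent v)

  children : ℕ → DVertex → List DVertex
  children c w = map (_∷ w) (upTo c)

  nextLevel : ℕ → List DVertex → List DVertex
  nextLevel c = concatMap (children c)

  branching : ℕ → ℕ → ℕ
  branching k zero    = k
  branching k (suc _) = k ∸ 1

  level-suc : ∀ k l → level k (suc l) ≡ nextLevel (branching k l) (level k l)
  level-suc k zero    = sym (++-identityʳ _)
  level-suc k (suc l) = refl

  ∈-level⁺ : ∀ k x → Valid k x → x ∈ level k (length x)
  ∈-level⁺ k []          _        = here refl
  ∈-level⁺ k (i ∷ [])    i<k      = ∈-map⁺ (_∷ []) (∈-upTo⁺ i<k)
  ∈-level⁺ k (i ∷ j ∷ x) (i<k , v) =
    ∈-concatMap⁺ (children (k ∸ 1)) (Any.map (λ { refl → ∈-map⁺ (_∷ j ∷ x) (∈-upTo⁺ i<k) }) (∈-level⁺ k (j ∷ x) v))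

  ∈-nextLevel⁻ : ∀ c ws x → x ∈ nextLevel c ws → ∃[ i ] ∃[ w ] (i < c × w ∈ ws × x ≡ i ∷ w)
  ∈-nextLevel⁻ c ws x x∈ with find (∈-concatMap⁻ (children c) {xs = ws} x∈)
  ... | w , w∈ , x∈ch with ∈-map⁻ (_∷ w) x∈ch
  ...   | i , i∈ , x≡ = i , w , ∈-upTo⁻ i∈ , w∈ , x≡

  ∈-level⁻ : ∀ k l x → x ∈ level k l → Valid k x × length x ≡ l
  ∈-level⁻ k zero          x (here refl) = tt , refl
  ∈-level⁻ k (suc zero)    x x∈ with ∈-map⁻ (_∷ []) x∈
  ... | i , i∈ , refl = ∈-upTo⁻ i∈ , refl
  ∈-level⁻ k (suc (suc l)) x x∈ with ∈-nextLevel⁻ (k ∸ 1) (level k (suc l)) x x∈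
  ... | i , w , i<c , w∈ , refl = extend w (∈-level⁻ k (suc l) w w∈)
    where
    extend : ∀ w → Valid k w × length w ≡ suc l → Valid k (i ∷ w) × length (i ∷ w) ≡ suc (suc l)
    extend (j ∷ w′) (vw , lw) = (i<c , vw) , cong suc lw

  ∈-vertices⁺ : ∀ n k x → Valid k x → length x ≤ n → x ∈ dVertices n k
  ∈-vertices⁺ zero    k [] v _   = here refl
  ∈-vertices⁺ (suc n) k x  v x≤ with m≤n⇒m<n∨m≡n x≤
  ... | inj₁ x< = ∈-++⁺ˡ (∈-vertices⁺ n k x v (≤-pred x<))
  ... | inj₂ x≡ = ∈-++⁺ʳ (dVertices n k) (subst (λ l → x ∈ level k l) x≡ (∈-level⁺ k x v))

  ∈-vertices⁻ : ∀ n k x → x ∈ dVertices n k → Valid k x × length x ≤ n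
  ∈-vertices⁻ zero    k x x∈ with ∈-level⁻ k zero x x∈
  ... | v , x≡0 = v , ≤-reflexive x≡0
  ∈-vertices⁻ (suc n) k x x∈ with ∈-++⁻ (dVertices n k) x∈
  ... | inj₁ x∈V with ∈-vertices⁻ n k x x∈V
  ...   | v , x≤ = v , m≤n⇒m≤1+n x≤
  ∈-vertices⁻ (suc n) k x x∈ | inj₂ x∈L with ∈-level⁻ k (suc n) x x∈L
  ...   | v , x≡ = v , ≤-reflexive x≡

  -- Graph distance in the dendrimer is tree distance

  any-true⁺ : ∀ (p : A → Bool) xs {x} → x ∈ xs → p x ≡ true → any p xs ≡ true
  any-true⁺ p (y ∷ xs) (here refl) px rewrite px = refl
  any-true⁺ p (y ∷ xs) (there x∈)  px rewrite any-true⁺ p xs x∈ px = ∨-zeroʳ (p y)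

  any-true⁻ : ∀ (p : A → Bool) xs → any p xs ≡ true → ∃[ x ] (x ∈ xs × p x ≡ true)
  any-true⁻ p (y ∷ xs) eq with p y in py
  ... | true  = y , here refl , py
  ... | false with any-true⁻ p xs eq
  ...   | x , x∈ , px = x , there x∈ , px

  ∧-true⁻ : ∀ a b → (a ∧ b) ≡ true → a ≡ true × b ≡ true
  ∧-true⁻ true true _ = refl , refl

  ∨-true⁻ : ∀ a b → (a ∨ b) ≡ true → a ≡ true ⊎ b ≡ true
  ∨-true⁻ true  b _  = inj₁ refl
  ∨-true⁻ false b eq = inj₂ eq

  isChild⇒ : ∀ u w → isChild u w ≡ true → ∃[ i ] (w ≡ i ∷ u)
  isChild⇒ u (i ∷ w) eq = i , cong (i ∷_) (sym (dEq-sound eq))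

  module _ (n k : ℕ) where

    private
      reachT : ℕ → DVertex → DVertex → Bool
      reachT = reach dEq (dendrimer n k)

    InTree : DVertex → Set
    InTree x = Valid k x × length x ≤ n

    reach⇒treeDist≤ : ∀ m u v → reachT m u v ≡ true → treeDist u v ≤ m
    reach⇒treeDist≤ zero    u v eq with dEq-sound eq
    ... | refl = ≤-reflexive (treeDist-refl u)
    reach⇒treeDist≤ (suc m) u v eq with any-true⁻ (λ w → dAdj u w ∧ reachT m w v) (dVertices n k) eq
    ... | w , _ , step with ∧-true⁻ (dAdj u w) (reachT m w v) step
    ...   | adj , rest with ∨-true⁻ (isChild u w) (isChild w u) adj
    ...     | inj₁ w-child with isChild⇒ u w w-child
    ...       | i , refl = ≤-trans (treeDist-parent≤ i u v) (s≤s (reach⇒treeDist≤ m w v rest))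
    reach⇒treeDist≤ (suc m) u v eq | w , _ , step | adj , rest | inj₂ u-child with isChild⇒ w u u-child
    ...       | i , refl = ≤-trans (treeDist-child≤ i w v) (s≤s (reach⇒treeDist≤ m w v rest))

    treeDist⇒reach : ∀ d u v → InTree u → InTree v → treeDist u v ≡ d → reachT d u v ≡ true
    treeDist⇒reach zero    u v _ _ u~v with treeDist≡0⇒≡ u v u~v
    ... | refl = dEq-refl u
    treeDist⇒reach (suc d) u v (vu , u≤n) iv u~v with descent u v d u~v
    ... | up i u′ refl p =
      any-true⁺ (λ w → dAdj u w ∧ reachT d w v) (dVertices n k) (∈-vertices⁺ n k u′ (proj₁ iu′) (proj₂ iu′))
        (trans (cong (_∧ reachT d u′ v) (trans (cong (isChild u u′ ∨_) (dEq-refl u′)) (∨-zeroʳ _)))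
               (treeDist⇒reach d u′ v iu′ iv p))
      where
      iu′ : InTree u′
      iu′ = Valid-parent vu , ≤-trans (n≤1+n _) u≤n
    ... | down j s p =
      any-true⁺ (λ w → dAdj u w ∧ reachT d w v) (dVertices n k) (∈-vertices⁺ n k (j ∷ u) (proj₁ iju) (proj₂ iju))
        (trans (cong (λ b → (b ∨ isChild (j ∷ u) u) ∧ reachT d (j ∷ u) v) (dEq-refl u))
               (treeDist⇒reach d (j ∷ u) v iju iv p))
      where
      iju : InTree (j ∷ u)
      iju = Valid-≼ s (proj₁ iv) , ≤-trans (length-mono s) (proj₂ iv)

    firstReach-least : ∀ fuel s d u v → s ≤ d → d < s + fuel → reachT d u v ≡ true →
                       (∀ e → s ≤ e → e < d → reachT e u v ≡ false) →
                       firstReach dEq (dendrimer n k) s fuel u v ≡ d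
    firstReach-least zero       s d u v s≤d d< _ _ = ⊥-elim (<⇒≱ d< (≤-trans (≤-reflexive (+-identityʳ s)) s≤d))
    firstReach-least (suc fuel) s d u v s≤d d< hit miss with m≤n⇒m<n∨m≡n s≤d
    ... | inj₂ refl = cong (λ b → if b then s else firstReach dEq (dendrimer n k) (suc s) fuel u v) hit
    ... | inj₁ s<d  =
      trans (cong (λ b → if b then s else firstReach dEq (dendrimer n k) (suc s) fuel u v) (miss s ≤-refl s<d))
            (firstReach-least fuel (suc s) d u v s<d (≤-trans d< (≤-reflexive (+-suc s fuel))) hit
                              (λ e s<e e<d → miss e (≤-trans (n≤1+n s) s<e) e<d))

    dist≡treeDist : ∀ u v → InTree u → InTree v → treeDist u v < length (dVertices n k) →
                    dist dEq (dendrimer n k) u v ≡ treeDist u v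
    dist≡treeDist u v iu iv d< =
      firstReach-least (length (dVertices n k)) 0 (treeDist u v) u v z≤n d<
        (treeDist⇒reach (treeDist u v) u v iu iv refl)
        (λ e _ e<d → ¬-not (λ r → <⇒≱ e<d (reach⇒treeDist≤ e u v r)))

  -- Distance sums between consecutive levels

  length-nextLevel : ∀ c ws → length (nextLevel c ws) ≡ c * length ws
  length-nextLevel c []       = sym (*-zeroʳ c)
  length-nextLevel c (w ∷ ws) = begin
    length (children c w ++ nextLevel c ws)        ≡⟨ length-++ (children c w) ⟩
    length (children c w) + length (nextLevel c ws) ≡⟨ cong₂ _+_ (trans (length-map _ (upTo c)) (length-upTo c))
                                                                 (length-nextLevel c ws) ⟩
    c + c * length ws                              ≡⟨ *-suc c (length ws) ⟨
    c * length (w ∷ ws)                            ∎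
    where open ≡-Reasoning

  sumOf-nextLevel : ∀ (f : DVertex → ℕ) c ws →
                    sumOf f (nextLevel c ws) ≡ sumOf (λ w → sumOf (λ i → f (i ∷ w)) (upTo c)) ws
  sumOf-nextLevel f c ws =
    trans (sumOf-concatMap f (children c) ws) (sumOf-cong ws (λ {w} _ → sumOf-map f (_∷ w) (upTo c)))

  sumOf-nextLevel-uniform : ∀ {f g : DVertex → ℕ} c ws →
                            (∀ {w} → w ∈ ws → ∀ {i} → i < c → f (i ∷ w) ≡ g w) →
                            sumOf f (nextLevel c ws) ≡ c * sumOf g ws
  sumOf-nextLevel-uniform {f} {g} c ws f≗g = begin
    sumOf f (nextLevel c ws)                          ≡⟨ sumOf-nextLevel f c ws ⟩
    sumOf (λ w → sumOf (λ i → f (i ∷ w)) (upTo c)) ws ≡⟨ sumOf-cong ws (λ {w} w∈ → row w w∈) ⟩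
    sumOf (λ w → c * g w) ws                          ≡⟨ sumOf-*ˡ c g ws ⟩
    c * sumOf g ws                                    ∎
    where
    open ≡-Reasoning
    row : ∀ w → w ∈ ws → sumOf (λ i → f (i ∷ w)) (upTo c) ≡ c * g w
    row w w∈ = begin
      sumOf (λ i → f (i ∷ w)) (upTo c) ≡⟨ sumOf-cong (upTo c) (λ i∈ → f≗g w∈ (∈-upTo⁻ i∈)) ⟩
      sumOf (λ _ → g w) (upTo c)       ≡⟨ sumOf-const (g w) (upTo c) ⟩
      length (upTo c) * g w            ≡⟨ cong (_* g w) (length-upTo c) ⟩
      c * g w                          ∎

  sumProduct-nextLevelʳ : ∀ {f : DVertex → DVertex → ℕ} {g} c as ws →
                          (∀ {a w} → a ∈ as → w ∈ ws → ∀ {j} → j < c → f a (j ∷ w) ≡ g a w) →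
                          sumProduct f as (nextLevel c ws) ≡ c * sumProduct g as ws
  sumProduct-nextLevelʳ {f} {g} c as ws f≗g =
    trans (sumOf-cong as (λ a∈ → sumOf-nextLevel-uniform c ws (f≗g a∈)))
          (sumOf-*ˡ c (λ a → sumOf (g a) ws) as)

  sumProduct-nextLevel : ∀ {f : DVertex → DVertex → ℕ} {g} c as ws →
                         (∀ {a w} → a ∈ as → w ∈ ws → ∀ {i j} → i < c → j < c → f (i ∷ a) (j ∷ w) ≡ g a w) →
                         sumProduct f (nextLevel c as) (nextLevel c ws) ≡ c * c * sumProduct g as ws
  sumProduct-nextLevel {f} {g} c as ws f≗g = begin
    sumProduct f (nextLevel c as) (nextLevel c ws)
      ≡⟨ sumOf-nextLevel-uniform c as (λ a∈ i<c → sumOf-nextLevel-uniform c ws (λ w∈ j<c → f≗g a∈ w∈ i<c j<c)) ⟩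
    c * sumOf (λ a → c * sumOf (g a) ws) as ≡⟨ cong (c *_) (sumOf-*ˡ c (λ a → sumOf (g a) ws) as) ⟩
    c * (c * sumProduct g as ws)           ≡⟨ *-assoc c c _ ⟨
    c * c * sumProduct g as ws             ∎
    where open ≡-Reasoning

  sumProduct-+const : ∀ (f : A → B → ℕ) e as bs →
                      sumProduct (λ a b → f a b + e) as bs ≡ sumProduct f as bs + length as * (length bs * e)
  sumProduct-+const f e as bs = begin
    sumOf (λ a → sumOf (λ b → f a b + e) bs) as         ≡⟨ sumOf-cong as (λ {a} _ → trans (sumOf-+ (f a) _ bs)
                                                                                           (cong (sumOf (f a) bs +_) (sumOf-const e bs))) ⟩
    sumOf (λ a → sumOf (f a) bs + length bs * e) as     ≡⟨ sumOf-+ (λ a → sumOf (f a) bs) _ as ⟩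
    sumProduct f as bs + sumOf (λ _ → length bs * e) as ≡⟨ cong (sumProduct f as bs +_) (sumOf-const _ as) ⟩
    sumProduct f as bs + length as * (length bs * e)    ∎
    where open ≡-Reasoning

  sumProduct-linear : ∀ (f g : A → B → ℕ) e as bs →
                      sumProduct (λ a b → f a b + e * g a b) as bs ≡ sumProduct f as bs + e * sumProduct g as bs
  sumProduct-linear f g e as bs = begin
    sumOf (λ a → sumOf (λ b → f a b + e * g a b) bs) as
      ≡⟨ sumOf-cong as (λ {a} _ → trans (sumOf-+ (f a) _ bs) (cong (sumOf (f a) bs +_) (sumOf-*ˡ e (g a) bs))) ⟩
    sumOf (λ a → sumOf (f a) bs + e * sumOf (g a) bs) as
      ≡⟨ sumOf-+ (λ a → sumOf (f a) bs) _ as ⟩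
    sumProduct f as bs + sumOf (λ a → e * sumOf (g a) bs) as
      ≡⟨ cong (sumProduct f as bs +_) (sumOf-*ˡ e (λ a → sumOf (g a) bs) as) ⟩
    sumProduct f as bs + e * sumProduct g as bs ∎
    where open ≡-Reasoning

  sumProduct-treeDist-deeper : ∀ c as ws m → (∀ {a} → a ∈ as → length a ≤ m) → (∀ {w} → w ∈ ws → length w ≡ m) →
    sumProduct treeDist as (nextLevel c ws) ≡ c * (sumProduct treeDist as ws + length as * length ws)
  sumProduct-treeDist-deeper c as ws m as≤m ws≡m = begin
    sumProduct treeDist as (nextLevel c ws)
      ≡⟨ sumProduct-nextLevelʳ c as ws (λ {a} {w} a∈ w∈ {j} _ →
           trans (treeDist-childʳ j a w (≤-trans (as≤m a∈) (≤-reflexive (sym (ws≡m w∈))))) (+-comm 1 _)) ⟩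
    c * sumProduct (λ a w → treeDist a w + 1) as ws
      ≡⟨ cong (c *_) (sumProduct-+const treeDist 1 as ws) ⟩
    c * (sumProduct treeDist as ws + length as * (length ws * 1))
      ≡⟨ cong (λ x → c * (sumProduct treeDist as ws + length as * x)) (*-identityʳ (length ws)) ⟩
    c * (sumProduct treeDist as ws + length as * length ws) ∎
    where open ≡-Reasoning

  sumProduct-treeDist-sameDepth : ∀ c as ws m → (∀ {a} → a ∈ as → length a ≡ m) → (∀ {w} → w ∈ ws → length w ≡ m) →
    sumProduct treeDist (nextLevel c as) (nextLevel c ws) + 2 * sumProduct eqIndicator (nextLevel c as) (nextLevel c ws)
      ≡ c * c * (sumProduct treeDist as ws + length as * (length ws * 2))
  sumProduct-treeDist-sameDepth c as ws m as≡m ws≡m = begin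
    sumProduct treeDist (nextLevel c as) (nextLevel c ws) + 2 * sumProduct eqIndicator (nextLevel c as) (nextLevel c ws)
      ≡⟨ sumProduct-linear treeDist eqIndicator 2 (nextLevel c as) (nextLevel c ws) ⟨
    sumProduct (λ x y → treeDist x y + 2 * eqIndicator x y) (nextLevel c as) (nextLevel c ws)
      ≡⟨ sumProduct-nextLevel c as ws (λ {a} {w} a∈ w∈ {i} {j} _ _ →
           treeDist-sameDepth-children i j a w (trans (as≡m a∈) (sym (ws≡m w∈)))) ⟩
    c * c * sumProduct (λ a w → treeDist a w + 2) as ws
      ≡⟨ cong (c * c *_) (sumProduct-+const treeDist 2 as ws) ⟩
    c * c * (sumProduct treeDist as ws + length as * (length ws * 2)) ∎
    where open ≡-Reasoning

  kronecker : ℕ → ℕ → ℕ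
  kronecker i j = if ⌊ i ≟ j ⌋ then 1 else 0

  kronecker-diag : ∀ i → kronecker i i ≡ 1
  kronecker-diag i = cong (λ b → if b then 1 else 0) (trans (isYes≗does (i ≟ i)) (dec-true (i ≟ i) refl))

  kronecker-≢ : ∀ {i j} → i ≢ j → kronecker i j ≡ 0
  kronecker-≢ {i} {j} i≢j = cong (λ b → if b then 1 else 0) (trans (isYes≗does (i ≟ j)) (dec-false (i ≟ j) i≢j))

  eqIndicator-cons : ∀ i j x y → eqIndicator (i ∷ x) (j ∷ y) ≡ kronecker i j * eqIndicator x y
  eqIndicator-cons i j x y with toSum (≡-dec _≟_ (i ∷ x) (j ∷ y))
  ... | inj₁ refl rewrite dEq-refl (i ∷ x) | dEq-refl x | kronecker-diag i = refl
  ... | inj₂ ≢ rewrite dEq-false ≢ with toSum (i ≟ j)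
  ...   | inj₂ i≢j rewrite kronecker-≢ i≢j = refl
  ...   | inj₁ refl rewrite dEq-false (≢ ∘ cong (i ∷_)) = sym (*-zeroʳ (kronecker i i))

  sumOf-upTo-suc : ∀ (f : ℕ → ℕ) c → sumOf f (upTo (suc c)) ≡ sumOf f (upTo c) + (f c + 0)
  sumOf-upTo-suc f c = trans (cong (sumOf f) (sym (upTo-∷ʳ c))) (sumOf-++ f (upTo c) [ c ])

  kronecker-sum₀ : ∀ i c → c ≤ i → sumOf (kronecker i) (upTo c) ≡ 0
  kronecker-sum₀ i zero    _   = refl
  kronecker-sum₀ i (suc c) c<i
    rewrite sumOf-upTo-suc (kronecker i) c | kronecker-sum₀ i c (≤-trans (n≤1+n c) c<i)
          | kronecker-≢ (λ i≡c → <⇒≢ c<i (sym i≡c)) = refl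

  kronecker-sum₁ : ∀ i c → i < c → sumOf (kronecker i) (upTo c) ≡ 1
  kronecker-sum₁ i (suc c) i<1+c rewrite sumOf-upTo-suc (kronecker i) c with m≤n⇒m<n∨m≡n (≤-pred i<1+c)
  ... | inj₁ i<c  rewrite kronecker-sum₁ i c i<c | kronecker-≢ (<⇒≢ i<c) = refl
  ... | inj₂ refl rewrite kronecker-sum₀ i i ≤-refl | kronecker-diag i = refl

  sumProduct-eqIndicator-nextLevel : ∀ c as ws →
    sumProduct eqIndicator (nextLevel c as) (nextLevel c ws) ≡ c * sumProduct eqIndicator as ws
  sumProduct-eqIndicator-nextLevel c as ws = sumOf-nextLevel-uniform c as row
    where
    row : ∀ {a} → a ∈ as → ∀ {i} → i < c → sumOf (eqIndicator (i ∷ a)) (nextLevel c ws) ≡ sumOf (eqIndicator a) ws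
    row {a} _ {i} i<c = begin
      sumOf (eqIndicator (i ∷ a)) (nextLevel c ws)
        ≡⟨ sumOf-nextLevel (eqIndicator (i ∷ a)) c ws ⟩
      sumOf (λ w → sumOf (λ j → eqIndicator (i ∷ a) (j ∷ w)) (upTo c)) ws
        ≡⟨ sumOf-cong ws (λ {w} _ → begin
             sumOf (λ j → eqIndicator (i ∷ a) (j ∷ w)) (upTo c) ≡⟨ sumOf-cong (upTo c) (λ {j} _ → eqIndicator-cons i j a w) ⟩
             sumOf (λ j → kronecker i j * eqIndicator a w) (upTo c) ≡⟨ sumOf-cong (upTo c) (λ {j} _ → *-comm _ (eqIndicator a w)) ⟩
             sumOf (λ j → eqIndicator a w * kronecker i j) (upTo c) ≡⟨ sumOf-*ˡ (eqIndicator a w) (kronecker i) (upTo c) ⟩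
             eqIndicator a w * sumOf (kronecker i) (upTo c)       ≡⟨ cong (eqIndicator a w *_) (kronecker-sum₁ i c i<c) ⟩
             eqIndicator a w * 1                                  ≡⟨ *-identityʳ _ ⟩
             eqIndicator a w                                      ∎) ⟩
      sumOf (eqIndicator a) ws ∎
      where open ≡-Reasoning

  -- Level statistics of the dendrimer

  levelSize : ℕ → ℕ → ℕ
  levelSize k l = length (level k l)

  size : ℕ → ℕ → ℕ
  size k l = length (dVertices l k)

  levelDistSum toLevelDistSum distSum : ℕ → ℕ → ℕ
  levelDistSum   k l = sumProduct treeDist (level k l) (level k l)
  toLevelDistSum k l = sumProduct treeDist (dVertices l k) (level k l)
  distSum        k l = sumProduct treeDist (dVertices l k) (dVertices l k)

  depth-level : ∀ k l {x} → x ∈ level k l → length x ≡ l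
  depth-level k l {x} x∈ = proj₂ (∈-level⁻ k l x x∈)

  depth-vertices : ∀ k l {x} → x ∈ dVertices l k → length x ≤ l
  depth-vertices k l {x} x∈ = proj₂ (∈-vertices⁻ l k x x∈)

  levelSize-suc : ∀ k l → levelSize k (suc l) ≡ branching k l * levelSize k l
  levelSize-suc k l = trans (cong length (level-suc k l)) (length-nextLevel (branching k l) (level k l))

  levelSize-closed : ∀ k l → levelSize k (suc l) ≡ k * (k ∸ 1) ^ l
  levelSize-closed k zero    = levelSize-suc k zero
  levelSize-closed k (suc l) = begin
    levelSize k (suc (suc l))      ≡⟨ levelSize-suc k (suc l) ⟩
    (k ∸ 1) * levelSize k (suc l)  ≡⟨ cong ((k ∸ 1) *_) (levelSize-closed k l) ⟩
    (k ∸ 1) * (k * (k ∸ 1) ^ l)    ≡⟨ x*[y*z]≡y*[x*z] (k ∸ 1) k _ ⟩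
    k * (k ∸ 1) ^ suc l            ∎
    where
    open ≡-Reasoning
    x*[y*z]≡y*[x*z] : ∀ x y z → x * (y * z) ≡ y * (x * z)
    x*[y*z]≡y*[x*z] = solve-∀

  size-suc : ∀ k l → size k (suc l) ≡ size k l + levelSize k (suc l)
  size-suc k l = length-++ (dVertices l k)

  eqIndicatorSum-level : ∀ k l → sumProduct eqIndicator (level k l) (level k l) ≡ levelSize k l
  eqIndicatorSum-level k zero    = cong (λ b → (if b then 1 else 0) + 0 + 0) (dEq-refl [])
  eqIndicatorSum-level k (suc l) = begin
    sumProduct eqIndicator (level k (suc l)) (level k (suc l))
      ≡⟨ cong (λ L → sumProduct eqIndicator L L) (level-suc k l) ⟩
    sumProduct eqIndicator (nextLevel c (level k l)) (nextLevel c (level k l))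
      ≡⟨ sumProduct-eqIndicator-nextLevel c (level k l) (level k l) ⟩
    c * sumProduct eqIndicator (level k l) (level k l)
      ≡⟨ cong (c *_) (eqIndicatorSum-level k l) ⟩
    c * levelSize k l
      ≡⟨ levelSize-suc k l ⟨
    levelSize k (suc l) ∎
    where
    open ≡-Reasoning
    c = branching k l

  -- The root level contributes nothing to the sums, so the branching k of
  -- the root may be replaced by the branching k ∸ 1 of all other vertices.
  branching-levelDistSum : ∀ k l → branching k l * branching k l * levelDistSum k l ≡ (k ∸ 1) * (k ∸ 1) * levelDistSum k l
  branching-levelDistSum k zero    = trans (*-zeroʳ (k * k)) (sym (*-zeroʳ ((k ∸ 1) * (k ∸ 1))))
  branching-levelDistSum k (suc l) = refl

  branching-toLevelDistSum : ∀ k l → branching k l * toLevelDistSum k l ≡ (k ∸ 1) * toLevelDistSum k l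
  branching-toLevelDistSum k zero    = trans (*-zeroʳ k) (sym (*-zeroʳ (k ∸ 1)))
  branching-toLevelDistSum k (suc l) = refl

  levelDistSum-suc : ∀ k l →
    levelDistSum k (suc l) + 2 * levelSize k (suc l)
      ≡ (k ∸ 1) * (k ∸ 1) * levelDistSum k l + 2 * (levelSize k (suc l) * levelSize k (suc l))
  levelDistSum-suc k l = begin
    levelDistSum k (suc l) + 2 * levelSize k (suc l)
      ≡⟨ cong (λ e → levelDistSum k (suc l) + 2 * e) (eqIndicatorSum-level k (suc l)) ⟨
    sumProduct treeDist (level k (suc l)) (level k (suc l)) + 2 * sumProduct eqIndicator (level k (suc l)) (level k (suc l))
      ≡⟨ cong (λ L → sumProduct treeDist L L + 2 * sumProduct eqIndicator L L) (level-suc k l) ⟩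
    sumProduct treeDist (nextLevel c L) (nextLevel c L) + 2 * sumProduct eqIndicator (nextLevel c L) (nextLevel c L)
      ≡⟨ sumProduct-treeDist-sameDepth c L L l (depth-level k l) (depth-level k l) ⟩
    c * c * (levelDistSum k l + N * (N * 2))
      ≡⟨ expand c (levelDistSum k l) N ⟩
    c * c * levelDistSum k l + 2 * ((c * N) * (c * N))
      ≡⟨ cong₂ (λ x y → x + 2 * (y * y)) (sym (branching-levelDistSum k l)) (levelSize-suc k l) ⟨
    (k ∸ 1) * (k ∸ 1) * levelDistSum k l + 2 * (levelSize k (suc l) * levelSize k (suc l)) ∎
    where
    open ≡-Reasoning
    c = branching k l
    L = level k l
    N = levelSize k l
    expand : ∀ c d n → c * c * (d + n * (n * 2)) ≡ c * c * d + 2 * ((c * n) * (c * n))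
    expand = solve-∀

  toLevelDistSum-suc : ∀ k l →
    toLevelDistSum k (suc l) ≡ (k ∸ 1) * toLevelDistSum k l + size k l * levelSize k (suc l) + levelDistSum k (suc l)
  toLevelDistSum-suc k l = begin
    toLevelDistSum k (suc l)
      ≡⟨ sumProduct-++ˡ treeDist (dVertices l k) (level k (suc l)) (level k (suc l)) ⟩
    sumProduct treeDist (dVertices l k) (level k (suc l)) + levelDistSum k (suc l)
      ≡⟨ cong (_+ levelDistSum k (suc l)) (trans (cong (sumProduct treeDist (dVertices l k)) (level-suc k l))
           (sumProduct-treeDist-deeper c (dVertices l k) (level k l) l (depth-vertices k l) (depth-level k l))) ⟩
    c * (toLevelDistSum k l + size k l * levelSize k l) + levelDistSum k (suc l)
      ≡⟨ cong (_+ levelDistSum k (suc l)) (distrib c (toLevelDistSum k l) (size k l) (levelSize k l)) ⟩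
    c * toLevelDistSum k l + size k l * (c * levelSize k l) + levelDistSum k (suc l)
      ≡⟨ cong₂ (λ x y → x + size k l * y + levelDistSum k (suc l)) (sym (branching-toLevelDistSum k l)) (levelSize-suc k l) ⟨
    (k ∸ 1) * toLevelDistSum k l + size k l * levelSize k (suc l) + levelDistSum k (suc l) ∎
    where
    open ≡-Reasoning
    c = branching k l
    distrib : ∀ c x v n → c * (x + v * n) ≡ c * x + v * (c * n)
    distrib = solve-∀

  distSum-suc : ∀ k l → distSum k (suc l) + levelDistSum k (suc l) ≡ distSum k l + 2 * toLevelDistSum k (suc l)
  distSum-suc k l = begin
    distSum k (suc l) + levelDistSum k (suc l)
      ≡⟨ cong (_+ levelDistSum k (suc l)) (trans (sumProduct-++ˡ treeDist V L′ (V ++ L′))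
                                                 (cong₂ _+_ (sumProduct-++ʳ treeDist V V L′) (sumProduct-++ʳ treeDist L′ V L′))) ⟩
    distSum k l + S + (sumProduct treeDist L′ V + levelDistSum k (suc l)) + levelDistSum k (suc l)
      ≡⟨ cong (λ x → distSum k l + S + (x + levelDistSum k (suc l)) + levelDistSum k (suc l)) across ⟩
    distSum k l + S + (S + levelDistSum k (suc l)) + levelDistSum k (suc l)
      ≡⟨ regroup (distSum k l) S (levelDistSum k (suc l)) ⟩
    distSum k l + 2 * (S + levelDistSum k (suc l))
      ≡⟨ cong (λ x → distSum k l + 2 * x) (sumProduct-++ˡ treeDist V L′ L′) ⟨
    distSum k l + 2 * toLevelDistSum k (suc l) ∎
    where
    open ≡-Reasoning
    V  = dVertices l k
    L′ = level k (suc l)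
    S  = sumProduct treeDist V L′
    across : sumProduct treeDist L′ V ≡ S
    across = trans (sumProduct-swap treeDist L′ V) (sumOf-cong V (λ {a} _ → sumOf-cong L′ (λ {b} _ → treeDist-sym b a)))
    regroup : ∀ w s d → w + s + (s + d) + d ≡ w + 2 * (s + d)
    regroup = solve-∀

  size-large : ∀ r n → n + n < size (2 + r) n
  size-large r zero    = s≤s z≤n
  size-large r (suc n) = begin-strict
    suc n + suc n                            ≡⟨ cong suc (+-suc n n) ⟩
    suc (suc (n + n))                        ≡⟨ +-comm 2 (n + n) ⟩
    n + n + 2                                <⟨ +-monoˡ-< 2 (size-large r n) ⟩
    size (2 + r) n + 2                       ≤⟨ +-monoʳ-≤ (size (2 + r) n) two≤ ⟩
    size (2 + r) n + levelSize (2 + r) (suc n) ≡⟨ size-suc (2 + r) n ⟨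
    size (2 + r) (suc n)                     ∎
    where
    open ≤-Reasoning
    two≤ : 2 ≤ levelSize (2 + r) (suc n)
    two≤ = ≤-trans (m≤m*n 2 ((1 + r) ^ n) {{m^n≢0 (1 + r) n}})
                   (≤-trans (*-monoˡ-≤ ((1 + r) ^ n) (s≤s (s≤s (z≤n {r})))) (≤-reflexive (sym (levelSize-closed (2 + r) n))))

  treeDist<size : ∀ n r {x y} → x ∈ dVertices n (2 + r) → y ∈ dVertices n (2 + r) → treeDist x y < size (2 + r) n
  treeDist<size n r {x} {y} x∈ y∈ = begin-strict
    treeDist x y        ≤⟨ treeDist≤depths x y ⟩
    length x + length y ≤⟨ +-mono-≤ (depth-vertices (2 + r) n x∈) (depth-vertices (2 + r) n y∈) ⟩
    n + n               <⟨ size-large r n ⟩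
    size (2 + r) n      ∎
    where open ≤-Reasoning

  twice-wiener : ∀ n r → 2 * wiener dEq (dendrimer n (2 + r)) ≡ distSum (2 + r) n
  twice-wiener n r = begin
    2 * pairSum dEq (dendrimer n k) V         ≡⟨ cong (2 *_) (pairSum≡sumPairs V) ⟩
    2 * sumPairs (dist dEq (dendrimer n k)) V ≡⟨ cong (2 *_) (sumPairs-cong V dist≡) ⟩
    2 * sumPairs treeDist V                   ≡⟨ twice-sumPairs treeDist treeDist-sym treeDist-refl V ⟩
    distSum k n                               ∎
    where
    open ≡-Reasoning
    k = 2 + r
    V = dVertices n k
    pairSum≡sumPairs : ∀ xs → pairSum dEq (dendrimer n k) xs ≡ sumPairs (dist dEq (dendrimer n k)) xs
    pairSum≡sumPairs []       = refl
    pairSum≡sumPairs (x ∷ xs) = cong (sumOf (dist dEq (dendrimer n k) x) xs +_) (pairSum≡sumPairs xs)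
    dist≡ : ∀ {x y} → x ∈ V → y ∈ V → dist dEq (dendrimer n k) x y ≡ treeDist x y
    dist≡ {x} {y} x∈ y∈ =
      dist≡treeDist n k x y (∈-vertices⁻ n k x x∈) (∈-vertices⁻ n k y y∈) (treeDist<size n r x∈ y∈)

module DivisionFree where

  open import Data.List using (upTo)
  open import Data.Nat using (ℕ; zero; suc; _+_; _*_; _∸_; _^_; _≤_; NonZero)
  open import Data.Nat.Combinatorics using (_C_; nCk+nC[k+1]≡[n+1]C[k+1]; nC1≡n)
  open import Data.Nat.DivMod using (m*n/n≡m)
  open import Data.Nat.Properties using (*-zeroʳ; m+n∸n≡m; ^-distribˡ-+-*; +-suc; +-identityʳ)
  open import Data.Nat.Tactic.RingSolver using (solve-∀)
  open import Defs using (formula; divBy)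
  open import Relation.Binary.PropositionalEquality
  open Dendrimer using (sumOf; sumOf-upTo-suc)

  powerSum : ℕ → ℕ → ℕ
  powerSum r e = sumOf (suc r ^_) (upTo e)

  powerSum-closed : ∀ r e → r * powerSum r e + 1 ≡ suc r ^ e
  powerSum-closed r zero    = cong (_+ 1) (*-zeroʳ r)
  powerSum-closed r (suc e) = begin
    r * powerSum r (suc e) + 1                 ≡⟨ cong (λ s → r * s + 1) (sumOf-upTo-suc (suc r ^_) e) ⟩
    r * (powerSum r e + (suc r ^ e + 0)) + 1   ≡⟨ regroup r (powerSum r e) (suc r ^ e) ⟩
    r * powerSum r e + 1 + r * suc r ^ e       ≡⟨ cong (_+ r * suc r ^ e) (powerSum-closed r e) ⟩
    suc r ^ suc e                              ∎
    where
    open ≡-Reasoning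
    regroup : ∀ r s p → r * (s + (p + 0)) + 1 ≡ r * s + 1 + r * p
    regroup = solve-∀

  divBy-* : ∀ a d .{{_ : NonZero d}} → divBy (a * d) d ≡ a
  divBy-* a (suc d) = m*n/n≡m a (suc d)

  choose-two : ∀ q → (suc q C 2) * 2 ≡ suc q * q
  choose-two zero    = refl
  choose-two (suc q) = begin
    (suc (suc q) C 2) * 2         ≡⟨ cong (_* 2) (nCk+nC[k+1]≡[n+1]C[k+1] (suc q) 1) ⟨
    (suc q C 1 + suc q C 2) * 2   ≡⟨ cong (λ c → (c + suc q C 2) * 2) (nC1≡n (suc q)) ⟩
    (suc q + suc q C 2) * 2       ≡⟨ distrib (suc q) (suc q C 2) ⟩
    suc q * 2 + (suc q C 2) * 2   ≡⟨ cong (suc q * 2 +_) (choose-two q) ⟩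
    suc q * 2 + suc q * q         ≡⟨ regroup q ⟩
    suc (suc q) * suc q           ∎
    where
    open ≡-Reasoning
    distrib : ∀ a b → (a + b) * 2 ≡ a * 2 + b * 2
    distrib = solve-∀
    regroup : ∀ q → (1 + q) * 2 + (1 + q) * q ≡ (2 + q) * (1 + q)
    regroup = solve-∀

  -- The two summands of the formula, the first one indexed by l and the
  -- second one by i = l - 1.
  formulaTerm₁ formulaTerm₂ : ℕ → ℕ → ℕ → ℕ
  formulaTerm₁ n k l = (2 * l + 1) * k * (k ∸ 1) ^ l * divBy ((k ∸ 1) ^ n ∸ (k ∸ 1) ^ l) (k ∸ 2)
  formulaTerm₂ n k i = (2 * suc i) * divBy (k * (k ∸ 1) ^ (2 * suc i ∸ 1)) 2
                                   * divBy (k * (k ∸ 1) ^ (n ∸ suc i) ∸ 2) (k ∸ 2)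

  formula-summands : ∀ n k → formula n k ≡ sumOf (formulaTerm₁ n k) (upTo n) + sumOf (formulaTerm₂ n k) (upTo n)
  formula-summands n k = refl

  module _ (r : ℕ) .{{_ : NonZero r}} where

    private
      q k : ℕ
      q = suc r
      k = 2 + r

    quotient₁ : ∀ l e → divBy (q ^ (l + e) ∸ q ^ l) r ≡ q ^ l * powerSum r e
    quotient₁ l e = trans (cong (λ a → divBy a r) numerator) (divBy-* (q ^ l * powerSum r e) r)
      where
      numerator : q ^ (l + e) ∸ q ^ l ≡ q ^ l * powerSum r e * r
      numerator = begin
        q ^ (l + e) ∸ q ^ l                               ≡⟨ cong (_∸ q ^ l) (^-distribˡ-+-* q l e) ⟩
        q ^ l * q ^ e ∸ q ^ l                             ≡⟨ cong (λ x → q ^ l * x ∸ q ^ l) (powerSum-closed r e) ⟨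
        q ^ l * (r * powerSum r e + 1) ∸ q ^ l            ≡⟨ cong (_∸ q ^ l) (expand (q ^ l) r (powerSum r e)) ⟩
        q ^ l * powerSum r e * r + q ^ l ∸ q ^ l          ≡⟨ m+n∸n≡m _ (q ^ l) ⟩
        q ^ l * powerSum r e * r                          ∎
        where
        open ≡-Reasoning
        expand : ∀ p r s → p * (r * s + 1) ≡ p * s * r + p
        expand = solve-∀

    quotient₂ : ∀ i → divBy (k * q ^ (2 * suc i ∸ 1)) 2 ≡ (k C 2) * (q ^ i * q ^ i)
    quotient₂ i = trans (cong (λ a → divBy a 2) numerator) (divBy-* ((k C 2) * (q ^ i * q ^ i)) 2)
      where
      numerator : k * q ^ (2 * suc i ∸ 1) ≡ (k C 2) * (q ^ i * q ^ i) * 2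
      numerator = begin
        k * q ^ (2 * suc i ∸ 1)         ≡⟨ cong (λ e → k * q ^ e) exponent ⟩
        k * (q * q ^ (i + i))           ≡⟨ cong (λ x → k * (q * x)) (^-distribˡ-+-* q i i) ⟩
        k * (q * (q ^ i * q ^ i))       ≡⟨ reassoc k q (q ^ i * q ^ i) ⟩
        k * q * (q ^ i * q ^ i)         ≡⟨ cong (_* (q ^ i * q ^ i)) (choose-two q) ⟨
        (k C 2) * 2 * (q ^ i * q ^ i)   ≡⟨ swap (k C 2) (q ^ i * q ^ i) ⟩
        (k C 2) * (q ^ i * q ^ i) * 2   ∎
        where
        open ≡-Reasoning
        exponent : 2 * suc i ∸ 1 ≡ suc (i + i)
        exponent = trans (+-suc i (i + 0)) (cong (λ j → suc (i + j)) (+-identityʳ i))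
        reassoc : ∀ a b c → a * (b * c) ≡ a * b * c
        reassoc = solve-∀
        swap : ∀ c p → c * 2 * p ≡ c * p * 2
        swap = solve-∀

    quotient₃ : ∀ e → divBy (k * q ^ e ∸ 2) r ≡ 1 + k * powerSum r e
    quotient₃ e = trans (cong (λ a → divBy a r) numerator) (divBy-* (1 + k * powerSum r e) r)
      where
      numerator : k * q ^ e ∸ 2 ≡ (1 + k * powerSum r e) * r
      numerator = begin
        k * q ^ e ∸ 2                         ≡⟨ cong (λ x → k * x ∸ 2) (powerSum-closed r e) ⟨
        k * (r * powerSum r e + 1) ∸ 2        ≡⟨ cong (_∸ 2) (expand r (powerSum r e)) ⟩
        (1 + k * powerSum r e) * r + 2 ∸ 2    ≡⟨ m+n∸n≡m _ 2 ⟩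
        (1 + k * powerSum r e) * r            ∎
        where
        open ≡-Reasoning
        expand : ∀ r s → (2 + r) * (r * s + 1) ≡ (1 + (2 + r) * s) * r + 2
        expand = solve-∀

module ClosedForms where

  open import Defs using (wiener; dEq; dendrimer)

  open import Data.Integer using (ℤ; +_; -_; _+_; _-_; _*_; _^_; 0ℤ; 1ℤ)
  open import Data.Integer.Properties using (pos-+; pos-*; ^-distribˡ-+-*; *-cancelˡ-≡)
  open import Data.Integer.Tactic.RingSolver using (solve; solve-∀)
  open import Data.List using ([]; _∷_; upTo)
  import Data.Nat as Nat
  open Nat using (ℕ; zero; suc)
  import Data.Nat.Properties as Nat
  open import Data.Nat.Combinatorics using (_C_)
  open import Relation.Binary.PropositionalEquality
  open Dendrimer using (sumOf; sumOf-+; sumOf-upTo-suc)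

  -- A linear-combination certificate: x ≡ y follows from a ≡ b as soon as
  -- x - y normalises to c * (a - b).
  combine : ∀ {x y a b : ℤ} → a ≡ b → ∀ c → x ≡ y + c * (a - b) → x ≡ y
  combine {x} {y} {a} refl c x≡ = trans x≡ (solve (y ∷ c ∷ a ∷ []))

  Σℤ : ℕ → (ℕ → ℤ) → ℤ
  Σℤ zero    f = 0ℤ
  Σℤ (suc n) f = Σℤ n f + f n

  pos-^ : ∀ m n → + (m Nat.^ n) ≡ (+ m) ^ n
  pos-^ m zero    = refl
  pos-^ m (suc n) = trans (pos-* m (m Nat.^ n)) (cong (+ m *_) (pos-^ m n))

  ^-square : ∀ x n → (x * x) ^ n ≡ x ^ n * x ^ n
  ^-square x zero    = refl
  ^-square x (suc n) = trans (cong (x * x *_) (^-square x n)) (regroup x (x ^ n))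
    where
    regroup : ∀ x p → x * x * (p * p) ≡ x * p * (x * p)
    regroup = solve-∀

  pos-sumOf : ∀ (f : ℕ → ℕ) n → + sumOf f (upTo n) ≡ Σℤ n (λ l → + f l)
  pos-sumOf f zero    = refl
  pos-sumOf f (suc n) = begin
    + sumOf f (upTo (suc n))                  ≡⟨ cong +_ (sumOf-upTo-suc f n) ⟩
    + (sumOf f (upTo n) Nat.+ (f n Nat.+ 0))  ≡⟨ pos-+ (sumOf f (upTo n)) _ ⟩
    + sumOf f (upTo n) + + (f n Nat.+ 0)      ≡⟨ cong₂ _+_ (pos-sumOf f n) (cong +_ (Nat.+-identityʳ (f n))) ⟩
    Σℤ n (λ l → + f l) + + f n                ∎
    where open ≡-Reasoning

  geometric : ∀ x n → (x - 1ℤ) * Σℤ n (x ^_) ≡ x ^ n - 1ℤ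
  geometric x zero    = solve (x ∷ [])
  geometric x (suc n) = step x (Σℤ n (x ^_)) (x ^ n) (geometric x n)
    where
    step : ∀ x s p → (x - 1ℤ) * s ≡ p - 1ℤ → (x - 1ℤ) * (s + p) ≡ x * p - 1ℤ
    step x s p ih = combine ih 1ℤ (solve (x ∷ s ∷ p ∷ []))

  arithmeticoGeometric : ∀ x n →
    (x - 1ℤ) * (x - 1ℤ) * Σℤ n (λ l → + suc l * x ^ l) ≡ + n * x ^ suc n - + suc n * x ^ n + 1ℤ
  arithmeticoGeometric x zero    = solve (x ∷ [])
  arithmeticoGeometric x (suc n) =
    step x (+ n) (Σℤ n (λ l → + suc l * x ^ l)) (x ^ n) (arithmeticoGeometric x n)
    where
    step : ∀ x m s p → (x - 1ℤ) * (x - 1ℤ) * s ≡ m * (x * p) - (1ℤ + m) * p + 1ℤ →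
           (x - 1ℤ) * (x - 1ℤ) * (s + (1ℤ + m) * p) ≡ (1ℤ + m) * (x * (x * p)) - (1ℤ + (1ℤ + m)) * (x * p) + 1ℤ
    step x m s p ih = combine ih 1ℤ (solve (x ∷ m ∷ s ∷ p ∷ []))

  Σℤ-linear : ∀ n (s f g h j : ℕ → ℤ) r a b c d →
              (∀ l → l Nat.< n → r * s l ≡ a * f l + b * g l + c * h l + d * j l) →
              r * Σℤ n s ≡ a * Σℤ n f + b * Σℤ n g + c * Σℤ n h + d * Σℤ n j
  Σℤ-linear zero    s f g h j r a b c d _  = solve (r ∷ a ∷ b ∷ c ∷ d ∷ [])
  Σℤ-linear (suc n) s f g h j r a b c d eq =
    step (Σℤ-linear n s f g h j r a b c d (λ l l<n → eq l (Nat.m<n⇒m<1+n l<n))) (eq n Nat.≤-refl)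
    where
    step : ∀ {S F G H J x y z u v} → r * S ≡ a * F + b * G + c * H + d * J → r * x ≡ a * y + b * z + c * u + d * v →
           r * (S + x) ≡ a * (F + y) + b * (G + z) + c * (H + u) + d * (J + v)
    step {S} {F} {G} {H} {J} {x} {y} {z} {u} {v} eqS eqx =
      combine eqS 1ℤ (combine eqx 1ℤ (solve (r ∷ a ∷ b ∷ c ∷ d ∷ S ∷ F ∷ G ∷ H ∷ J ∷ x ∷ y ∷ z ∷ u ∷ v ∷ [])))

  -- Induction steps for the closed forms of the level statistics of T_{n,k},
  -- written in terms of r = k - 2 (so q = k - 1 = 1 + r), z = q ^ n and m = n.

  size-step : ∀ r z v v′ → let q = + 1 + r ; k = + 2 + r in
    r * v ≡ k * z - + 2 → v′ ≡ v + k * z → r * v′ ≡ k * (q * z) - + 2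
  size-step r z v v′ ih rec = combine ih 1ℤ (combine rec r (solve (r ∷ z ∷ v ∷ v′ ∷ [])))

  levelDistSum-step : ∀ r m z d d′ → let q = + 1 + r ; k = + 2 + r in
    q * q * r * d ≡ + 2 * k * (r * k * m * (z * z) + q * z - q * (z * z)) →
    d′ + + 2 * (k * z) ≡ q * q * d + + 2 * ((k * z) * (k * z)) →
    q * q * r * d′ ≡ + 2 * k * (r * k * (1ℤ + m) * ((q * z) * (q * z)) + q * (q * z) - q * ((q * z) * (q * z)))
  levelDistSum-step r m z d d′ ih rec = let q = + 1 + r in
    combine ih (q * q) (combine rec (q * q * r) (solve (r ∷ m ∷ z ∷ d ∷ d′ ∷ [])))

  toLevelDistSum-step : ∀ r m z v d′ x x′ → let q = + 1 + r ; k = + 2 + r in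
    q * q * r * r * x ≡ q * (+ 2 * k * k * r * m * (z * z) - k * (+ 3 * q + 1ℤ) * z * (z - 1ℤ)) →
    r * v ≡ k * z - + 2 →
    q * q * r * d′ ≡ + 2 * k * (r * k * (1ℤ + m) * ((q * z) * (q * z)) + q * (q * z) - q * ((q * z) * (q * z))) →
    x′ ≡ q * x + v * (k * z) + d′ →
    q * q * r * r * x′ ≡ q * (+ 2 * k * k * r * (1ℤ + m) * ((q * z) * (q * z)) - k * (+ 3 * q + 1ℤ) * (q * z) * (q * z - 1ℤ))
  toLevelDistSum-step r m z v d′ x x′ ih size d′≡ rec = let q = + 1 + r ; k = + 2 + r in
    combine ih q (combine size (q * q * r * k * z) (combine d′≡ r (combine rec (q * q * r * r)
      (solve (r ∷ m ∷ z ∷ v ∷ d′ ∷ x ∷ x′ ∷ [])))))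

  distSum-step : ∀ r m z d′ x′ w w′ → let q = + 1 + r ; k = + 2 + r in
    q * q * r * r * r * w ≡ q * q * (+ 2 * k * (k * r * m * (z * z) + + 2 * k * z - (+ 2 * q + 1ℤ) * (z * z) - 1ℤ)) →
    q * q * r * r * x′ ≡ q * (+ 2 * k * k * r * (1ℤ + m) * ((q * z) * (q * z)) - k * (+ 3 * q + 1ℤ) * (q * z) * (q * z - 1ℤ)) →
    q * q * r * d′ ≡ + 2 * k * (r * k * (1ℤ + m) * ((q * z) * (q * z)) + q * (q * z) - q * ((q * z) * (q * z))) →
    w′ + d′ ≡ w + + 2 * x′ →
    q * q * r * r * r * w′ ≡ q * q * (+ 2 * k * (k * r * (1ℤ + m) * ((q * z) * (q * z)) + + 2 * k * (q * z)
                                                   - (+ 2 * q + 1ℤ) * ((q * z) * (q * z)) - 1ℤ))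
  distSum-step r m z d′ x′ w w′ ih x′≡ d′≡ rec = let q = + 1 + r in
    combine ih 1ℤ (combine x′≡ (+ 2 * r) (combine d′≡ (- (r * r)) (combine rec (q * q * r * r * r)
      (solve (r ∷ m ∷ z ∷ d′ ∷ x′ ∷ w ∷ w′ ∷ [])))))

  -- A summand of the formula after clearing the denominators k - 2 and 2, where
  -- p = q^l, e = q^(n-l-1), g₁ = Σ_{j ≤ n-l-1} q^j, g₂ = Σ_{j < n-l-1} q^j and h = k(k-1)/2.
  formula-term-step : ∀ r m p e g₁ g₂ h → let q = + 1 + r ; k = + 2 + r in
    r * g₁ ≡ q * e - 1ℤ → r * g₂ ≡ e - 1ℤ → h * + 2 ≡ k * q →
    r * ((+ 2 * m + 1ℤ) * k * p * (p * g₁) + + 2 * (1ℤ + m) * (h * (p * p)) * (1ℤ + k * g₂))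
      ≡ k * (p * (q * e)) * (k + + 2) * ((1ℤ + m) * p) + - (k * (p * (q * e))) * p
        + - (+ 2 * k * k) * ((1ℤ + m) * (p * p)) + k * (p * p)
  formula-term-step r m p e g₁ g₂ h g₁≡ g₂≡ h≡ = let q = + 1 + r ; k = + 2 + r in
    combine g₁≡ ((+ 2 * m + 1ℤ) * k * p * p) (combine g₂≡ (+ 2 * (1ℤ + m) * h * p * p * k)
      (combine h≡ ((1ℤ + m) * p * p * (k * e - + 2)) (solve (r ∷ m ∷ p ∷ e ∷ g₁ ∷ g₂ ∷ h ∷ []))))

  -- g₁, h₁ (resp. g₂, h₂) stand for Σ_{l<n} x^l and Σ_{l<n} (l+1) x^l with x = q (resp. x = q²).
  formula-closed-step : ∀ r m z f g₁ h₁ g₂ h₂ → let q = + 1 + r ; k = + 2 + r in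
    r * f ≡ k * z * (k + + 2) * h₁ + - (k * z) * g₁ + - (+ 2 * k * k) * h₂ + k * g₂ →
    (q - 1ℤ) * g₁ ≡ z - 1ℤ →
    (q - 1ℤ) * (q - 1ℤ) * h₁ ≡ m * (q * z) - (1ℤ + m) * z + 1ℤ →
    (q * q - 1ℤ) * g₂ ≡ z * z - 1ℤ →
    (q * q - 1ℤ) * (q * q - 1ℤ) * h₂ ≡ m * (q * q * (z * z)) - (1ℤ + m) * (z * z) + 1ℤ →
    k * k * (r * r * r * (+ 2 * f)) ≡ k * k * (+ 2 * k * (k * r * m * (z * z) + + 2 * k * z - (+ 2 * q + 1ℤ) * (z * z) - 1ℤ))
  formula-closed-step r m z f g₁ h₁ g₂ h₂ f≡ g₁≡ h₁≡ g₂≡ h₂≡ = let k = + 2 + r in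
    combine f≡ (+ 2 * k * k * r * r) (combine h₁≡ (+ 2 * k * k * k * z * (k + + 2)) (combine g₁≡ (- (+ 2 * k * k * k * z * r))
      (combine h₂≡ (- (+ 4 * k * k)) (combine g₂≡ (+ 2 * k * k * r)
        (solve (r ∷ m ∷ z ∷ f ∷ g₁ ∷ h₁ ∷ g₂ ∷ h₂ ∷ []))))))

  module _ (r : ℕ) where

    open Dendrimer using (levelSize; size; levelDistSum; toLevelDistSum; distSum;
                          levelSize-closed; size-suc; levelDistSum-suc; toLevelDistSum-suc; distSum-suc)

    private
      k : ℕ
      k = 2 Nat.+ r
      R Q K : ℤ
      R = + r
      Q = + suc r
      K = + k
      Z : ℕ → ℤ
      Z n = Q ^ n

    levelSize-ℤ : ∀ n → + levelSize k (suc n) ≡ K * Z n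
    levelSize-ℤ n = trans (cong +_ (levelSize-closed k n)) (trans (pos-* k (suc r Nat.^ n)) (cong (K *_) (pos-^ (suc r) n)))

    size-closed : ∀ n → R * + size k n ≡ K * Z n - + 2
    size-closed zero    = base R
      where
      base : ∀ r → r * + 1 ≡ (+ 2 + r) * 1ℤ - + 2
      base = solve-∀
    size-closed (suc n) = size-step R (Z n) (+ size k n) (+ size k (suc n)) (size-closed n) (begin
      + size k (suc n)                         ≡⟨ cong +_ (size-suc k n) ⟩
      + (size k n Nat.+ levelSize k (suc n))   ≡⟨ pos-+ (size k n) _ ⟩
      + size k n + + levelSize k (suc n)       ≡⟨ cong (_+_ (+ size k n)) (levelSize-ℤ n) ⟩
      + size k n + K * Z n                     ∎)
      where open ≡-Reasoning

    levelDistSum-closed : ∀ n → Q * Q * R * + levelDistSum k n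
                                ≡ + 2 * K * (R * K * + n * (Z n * Z n) + Q * Z n - Q * (Z n * Z n))
    levelDistSum-closed zero    = base R
      where
      base : ∀ r → let q = + 1 + r ; k = + 2 + r in
                 q * q * r * 0ℤ ≡ + 2 * k * (r * k * 0ℤ * (1ℤ * 1ℤ) + q * 1ℤ - q * (1ℤ * 1ℤ))
      base = solve-∀
    levelDistSum-closed (suc n) =
      levelDistSum-step R (+ n) (Z n) (+ levelDistSum k n) (+ levelDistSum k (suc n)) (levelDistSum-closed n) (begin
        + D′ + + 2 * (K * Z n)                      ≡⟨ cong (λ x → + D′ + + 2 * x) (levelSize-ℤ n) ⟨
        + D′ + + 2 * + N′                           ≡⟨ cong (_+_ (+ D′)) (pos-* 2 N′) ⟨
        + D′ + + (2 Nat.* N′)                        ≡⟨ pos-+ D′ _ ⟨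
        + (D′ Nat.+ 2 Nat.* N′)                      ≡⟨ cong +_ (levelDistSum-suc k n) ⟩
        + (suc r Nat.* suc r Nat.* D Nat.+ 2 Nat.* (N′ Nat.* N′))
          ≡⟨ pos-+ (suc r Nat.* suc r Nat.* D) _ ⟩
        + (suc r Nat.* suc r Nat.* D) + + (2 Nat.* (N′ Nat.* N′))
          ≡⟨ cong₂ _+_ (trans (pos-* (suc r Nat.* suc r) D) (cong (_* + D) (pos-* (suc r) (suc r))))
                       (trans (pos-* 2 (N′ Nat.* N′)) (cong (+ 2 *_) (trans (pos-* N′ N′) (cong₂ _*_ (levelSize-ℤ n) (levelSize-ℤ n))))) ⟩
        Q * Q * + D + + 2 * ((K * Z n) * (K * Z n)) ∎)
      where
      open ≡-Reasoning
      D = levelDistSum k n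
      D′ = levelDistSum k (suc n)
      N′ = levelSize k (suc n)

    toLevelDistSum-closed : ∀ n → Q * Q * R * R * + toLevelDistSum k n
                                  ≡ Q * (+ 2 * K * K * R * + n * (Z n * Z n) - K * (+ 3 * Q + 1ℤ) * Z n * (Z n - 1ℤ))
    toLevelDistSum-closed zero    = base R
      where
      base : ∀ r → let q = + 1 + r ; k = + 2 + r in
                 q * q * r * r * 0ℤ ≡ q * (+ 2 * k * k * r * 0ℤ * (1ℤ * 1ℤ) - k * (+ 3 * q + 1ℤ) * 1ℤ * (1ℤ - 1ℤ))
      base = solve-∀
    toLevelDistSum-closed (suc n) =
      toLevelDistSum-step R (+ n) (Z n) (+ size k n) (+ D′) (+ X) (+ X′)
        (toLevelDistSum-closed n) (size-closed n) (levelDistSum-closed (suc n)) (begin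
        + X′                                                      ≡⟨ cong +_ (toLevelDistSum-suc k n) ⟩
        + (suc r Nat.* X Nat.+ size k n Nat.* N′ Nat.+ D′)         ≡⟨ pos-+ (suc r Nat.* X Nat.+ size k n Nat.* N′) D′ ⟩
        + (suc r Nat.* X Nat.+ size k n Nat.* N′) + + D′           ≡⟨ cong (_+ + D′) (pos-+ (suc r Nat.* X) _) ⟩
        + (suc r Nat.* X) + + (size k n Nat.* N′) + + D′           ≡⟨ cong₂ (λ a b → a + b + + D′)
                                                                         (pos-* (suc r) X)
                                                                         (trans (pos-* (size k n) N′) (cong (_*_ (+ size k n)) (levelSize-ℤ n))) ⟩
        Q * + X + + size k n * (K * Z n) + + D′                     ∎)
      where
      open ≡-Reasoning
      X = toLevelDistSum k n
      X′ = toLevelDistSum k (suc n)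
      D′ = levelDistSum k (suc n)
      N′ = levelSize k (suc n)

    distSum-closed : ∀ n → Q * Q * R * R * R * + distSum k n
                           ≡ Q * Q * (+ 2 * K * (K * R * + n * (Z n * Z n) + + 2 * K * Z n - (+ 2 * Q + 1ℤ) * (Z n * Z n) - 1ℤ))
    distSum-closed zero    = base R
      where
      base : ∀ r → let q = + 1 + r ; k = + 2 + r in
                 q * q * r * r * r * 0ℤ ≡ q * q * (+ 2 * k * (k * r * 0ℤ * (1ℤ * 1ℤ) + + 2 * k * 1ℤ - (+ 2 * q + 1ℤ) * (1ℤ * 1ℤ) - 1ℤ))
      base = solve-∀
    distSum-closed (suc n) =
      distSum-step R (+ n) (Z n) (+ D′) (+ X′) (+ W) (+ W′)
        (distSum-closed n) (toLevelDistSum-closed (suc n)) (levelDistSum-closed (suc n)) (begin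
        + W′ + + D′               ≡⟨ pos-+ W′ D′ ⟨
        + (W′ Nat.+ D′)           ≡⟨ cong +_ (distSum-suc k n) ⟩
        + (W Nat.+ 2 Nat.* X′)    ≡⟨ trans (pos-+ W _) (cong (_+_ (+ W)) (pos-* 2 X′)) ⟩
        + W + + 2 * + X′          ∎)
      where
      open ≡-Reasoning
      W = distSum k n
      W′ = distSum k (suc n)
      X′ = toLevelDistSum k (suc n)
      D′ = levelDistSum k (suc n)

    twice-wiener-closed : ∀ n → R * R * R * + (2 Nat.* wiener dEq (dendrimer n k))
                                ≡ + 2 * K * (K * R * + n * (Z n * Z n) + + 2 * K * Z n - (+ 2 * Q + 1ℤ) * (Z n * Z n) - 1ℤ)
    twice-wiener-closed n rewrite Dendrimer.twice-wiener n r =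
      *-cancelˡ-≡ (Q * Q) _ _ (reassoc Q R (+ distSum k n) _ (distSum-closed n))
      where
      reassoc : ∀ q r w p → q * q * r * r * r * w ≡ q * q * p → q * q * (r * r * r * w) ≡ q * q * p
      reassoc q r w p eq = combine eq 1ℤ (solve (q ∷ r ∷ w ∷ p ∷ []))

    powerSum-ℤ : ∀ e → R * + DivisionFree.powerSum r e ≡ Q ^ e - 1ℤ
    powerSum-ℤ e = move (begin
      R * + G + 1ℤ                  ≡⟨ cong (_+ 1ℤ) (pos-* r G) ⟨
      + (r Nat.* G) + 1ℤ            ≡⟨ pos-+ (r Nat.* G) 1 ⟨
      + (r Nat.* G Nat.+ 1)         ≡⟨ cong +_ (DivisionFree.powerSum-closed r e) ⟩
      + (suc r Nat.^ e)             ≡⟨ pos-^ (suc r) e ⟩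
      Q ^ e                         ∎)
      where
      open ≡-Reasoning
      G = DivisionFree.powerSum r e
      move : ∀ {a b} → a + 1ℤ ≡ b → a ≡ b - 1ℤ
      move {a} {b} eq = combine eq 1ℤ (solve (a ∷ b ∷ []))

    choose-two-ℤ : + (k C 2) * + 2 ≡ K * Q
    choose-two-ℤ = trans (sym (pos-* (k C 2) 2)) (trans (cong +_ (DivisionFree.choose-two (suc r))) (pos-* k (suc r)))

    module _ .{{_ : Nat.NonZero r}} where

      open DivisionFree using (powerSum; formulaTerm₁; formulaTerm₂; formula-summands; quotient₁; quotient₂; quotient₃)

      formulaTerm₁-ℤ : ∀ l e → + formulaTerm₁ (l Nat.+ suc e) k l
                               ≡ (+ 2 * + l + 1ℤ) * K * Q ^ l * (Q ^ l * + powerSum r (suc e))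
      formulaTerm₁-ℤ l e = begin
        + formulaTerm₁ (l Nat.+ suc e) k l
          ≡⟨ cong (λ d → + (c Nat.* k Nat.* p Nat.* d)) (quotient₁ r l (suc e)) ⟩
        + (c Nat.* k Nat.* p Nat.* (p Nat.* powerSum r (suc e)))
          ≡⟨ trans (pos-* (c Nat.* k Nat.* p) _) (cong₂ _*_ (trans (pos-* (c Nat.* k) p) (cong₂ _*_ (pos-* c k) refl)) refl) ⟩
        + c * K * + p * + (p Nat.* powerSum r (suc e))
          ≡⟨ cong (λ y → + c * K * + p * y) (pos-* p (powerSum r (suc e))) ⟩
        + c * K * + p * (+ p * + powerSum r (suc e))
          ≡⟨ cong₂ (λ x y → x * K * y * (y * + powerSum r (suc e)))
                   (trans (pos-+ (2 Nat.* l) 1) (cong (_+ 1ℤ) (pos-* 2 l))) (pos-^ (suc r) l) ⟩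
        (+ 2 * + l + 1ℤ) * K * Q ^ l * (Q ^ l * + powerSum r (suc e)) ∎
        where
        open ≡-Reasoning
        c = 2 Nat.* l Nat.+ 1
        p = suc r Nat.^ l

      formulaTerm₂-ℤ : ∀ l e → + formulaTerm₂ (l Nat.+ suc e) k l
                               ≡ + 2 * (1ℤ + + l) * (+ (k C 2) * (Q ^ l * Q ^ l)) * (1ℤ + K * + powerSum r e)
      formulaTerm₂-ℤ l e = begin
        + formulaTerm₂ (l Nat.+ suc e) k l
          ≡⟨ cong₂ (λ d d′ → + (2 Nat.* suc l Nat.* d Nat.* d′)) (quotient₂ r l)
                   (trans (cong (λ x → divBy (k Nat.* suc r Nat.^ x Nat.∸ 2) r) exponent) (quotient₃ r e)) ⟩
        + (2 Nat.* suc l Nat.* ((k C 2) Nat.* (p Nat.* p)) Nat.* (1 Nat.+ k Nat.* powerSum r e))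
          ≡⟨ trans (pos-* (2 Nat.* suc l Nat.* ((k C 2) Nat.* (p Nat.* p))) (1 Nat.+ k Nat.* powerSum r e))
                   (cong (_* + (1 Nat.+ k Nat.* powerSum r e))
                         (trans (pos-* (2 Nat.* suc l) ((k C 2) Nat.* (p Nat.* p)))
                                (cong (_* + ((k C 2) Nat.* (p Nat.* p))) (pos-* 2 (suc l))))) ⟩
        + 2 * + suc l * + ((k C 2) Nat.* (p Nat.* p)) * + (1 Nat.+ k Nat.* powerSum r e)
          ≡⟨ cong₂ (λ x y → + 2 * + suc l * x * y)
                   (trans (pos-* (k C 2) (p Nat.* p)) (cong (_*_ (+ (k C 2))) (trans (pos-* p p) (cong₂ _*_ (pos-^ (suc r) l) (pos-^ (suc r) l)))))
                   (trans (pos-+ 1 (k Nat.* powerSum r e)) (cong (_+_ 1ℤ) (pos-* k (powerSum r e)))) ⟩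
        + 2 * (1ℤ + + l) * (+ (k C 2) * (Q ^ l * Q ^ l)) * (1ℤ + K * + powerSum r e) ∎
        where
        open ≡-Reasoning
        p = suc r Nat.^ l
        exponent : l Nat.+ suc e Nat.∸ suc l ≡ e
        exponent = trans (cong (Nat._∸ suc l) (Nat.+-suc l e)) (Nat.m+n∸m≡n l e)

      cleared : ℕ → ℕ → ℤ
      cleared n l = K * Z n * (K + + 2) * (+ suc l * Q ^ l) + - (K * Z n) * Q ^ l
                    + - (+ 2 * K * K) * (+ suc l * (Q * Q) ^ l) + K * (Q * Q) ^ l

      formulaTerms-cleared : ∀ n l → l Nat.< n → R * + (formulaTerm₁ n k l Nat.+ formulaTerm₂ n k l) ≡ cleared n l
      formulaTerms-cleared n l l<n =
        subst (λ n → R * + (formulaTerm₁ n k l Nat.+ formulaTerm₂ n k l) ≡ cleared n l)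
              (trans (Nat.+-suc l e) (Nat.m+[n∸m]≡n l<n)) (begin
        R * + (formulaTerm₁ n′ k l Nat.+ formulaTerm₂ n′ k l)
          ≡⟨ cong (R *_) (pos-+ (formulaTerm₁ n′ k l) (formulaTerm₂ n′ k l)) ⟩
        R * (+ formulaTerm₁ n′ k l + + formulaTerm₂ n′ k l)
          ≡⟨ cong₂ (λ a b → R * (a + b)) (formulaTerm₁-ℤ l e) (formulaTerm₂-ℤ l e) ⟩
        R * ((+ 2 * + l + 1ℤ) * K * Q ^ l * (Q ^ l * + powerSum r (suc e))
             + + 2 * (1ℤ + + l) * (+ (k C 2) * (Q ^ l * Q ^ l)) * (1ℤ + K * + powerSum r e))
          ≡⟨ formula-term-step R (+ l) (Q ^ l) (Q ^ e) (+ powerSum r (suc e)) (+ powerSum r e) (+ (k C 2))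
                               (powerSum-ℤ (suc e)) (powerSum-ℤ e) choose-two-ℤ ⟩
        K * (Q ^ l * Q ^ suc e) * (K + + 2) * (+ suc l * Q ^ l) + - (K * (Q ^ l * Q ^ suc e)) * Q ^ l
          + - (+ 2 * K * K) * (+ suc l * (Q ^ l * Q ^ l)) + K * (Q ^ l * Q ^ l)
          ≡⟨ cong₂ (λ z s → K * z * (K + + 2) * (+ suc l * Q ^ l) + - (K * z) * Q ^ l
                            + - (+ 2 * K * K) * (+ suc l * s) + K * s)
                   (sym (^-distribˡ-+-* Q l (suc e))) (sym (^-square Q l)) ⟩
        cleared n′ l ∎)
        where
        open ≡-Reasoning
        e = n Nat.∸ suc l
        n′ = l Nat.+ suc e

      twice-formula-closed : ∀ n → R * R * R * + (2 Nat.* formula n k)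
                                   ≡ + 2 * K * (K * R * + n * (Z n * Z n) + + 2 * K * Z n - (+ 2 * Q + 1ℤ) * (Z n * Z n) - 1ℤ)
      twice-formula-closed n = trans (cong (R * R * R *_) (pos-* 2 (formula n k))) (
        *-cancelˡ-≡ (K * K) _ _
          (formula-closed-step R (+ n) (Z n) (+ formula n k) G₁ H₁ G₂ H₂
            (trans (cong (R *_) formula-ℤ)
                   (Σℤ-linear n _ (λ l → + suc l * Q ^ l) (Q ^_) (λ l → + suc l * (Q * Q) ^ l) ((Q * Q) ^_)
                              R (K * Z n * (K + + 2)) (- (K * Z n)) (- (+ 2 * K * K)) K (formulaTerms-cleared n)))
            (geometric Q n)
            (arithmeticoGeometric Q n)
            (trans (geometric (Q * Q) n) (cong (_- 1ℤ) (^-square Q n)))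
            (trans (arithmeticoGeometric (Q * Q) n)
                   (cong (λ s → + n * (Q * Q * s) - + suc n * s + 1ℤ) (^-square Q n)))))
        where
        G₁ = Σℤ n (Q ^_)
        H₁ = Σℤ n (λ l → + suc l * Q ^ l)
        G₂ = Σℤ n ((Q * Q) ^_)
        H₂ = Σℤ n (λ l → + suc l * (Q * Q) ^ l)
        formula-ℤ : + formula n k ≡ Σℤ n (λ l → + (formulaTerm₁ n k l Nat.+ formulaTerm₂ n k l))
        formula-ℤ = trans (cong +_ (trans (formula-summands n k) (sym (sumOf-+ (formulaTerm₁ n k) (formulaTerm₂ n k) (upTo n)))))
                          (pos-sumOf (λ l → formulaTerm₁ n k l Nat.+ formulaTerm₂ n k l) n)

open import Data.Nat using (suc; s≤s)
open import Data.Nat.Properties using (*-cancelˡ-≡)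
open import Data.Integer using (+_; _*_)
open import Data.Integer.Properties as ℤ using (+-injective)
open import Relation.Binary.PropositionalEquality using (trans; sym)

corollary3 : (n k : ℕ) → 1 ≤ n → 3 ≤ k →
    wiener dEq (dendrimer n k) ≡ formula n k
corollary3 n 1                   _ (s≤s ())
corollary3 n 2                   _ (s≤s (s≤s ()))
corollary3 n (suc (suc (suc t))) _ _ =
  *-cancelˡ-≡ _ _ 2 (+-injective (ℤ.*-cancelˡ-≡ (R * R * R) _ _
    (trans (ClosedForms.twice-wiener-closed r n) (sym (ClosedForms.twice-formula-closed r n)))))
  where
  r = suc t
  R = + r
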